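{- Let $G$ be a vertex-transitive nut graph on vertex set $\{1,\dots,n\}$ and let $\mathbf{x} = [x_1\ \ldots\ x_n]^\intercal$ be a non-zero vector in $\ker \mathbf{A}(G)$. Then: (a) for every $\alpha \in \mathrm{Aut}(G)$, either $\mathbf{x}^\alpha = \mathbf{x}$ or $\mathbf{x}^\alpha = -\mathbf{x}$, where $\mathbf{x}^\alpha = [x_{1^\alpha}\ \ldots\ x_{n^\alpha}]^\intercal$; (b) $|x_i| = |x_j|$ for all $i,j$; (c) $\mathbf{x}$ can be scaled so that all its entries lie in $\{+1,-1\}$; (d) the (common) degree $d(G)$ and the order $n$ are both even.
   Context: All graphs are finite, simple and connected. A nut graph is a graph $G$ whose adjacency matrix $\mathbf{A}(G)$ has one-dimensional kernel spanned by a vector with no zero entry; the isolated vertex $K_1$ is excluded as trivial, so nut graphs have at least $7$ vertices. $\mathrm{Aut}(G)$ is the full automorphism group, and $v^\alpha$ denotes the image of vertex $v$ under $\alpha$.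
   Formalization: The vector $\mathbf{x}$ has rational entries, and the kernel of $\mathbf{A}(G)$ defining a nut graph is taken over the rationals. -}

module Defs where

open import Data.Bool using (Bool; true; false; if_then_else_)
open import Data.Nat using (ℕ; zero; suc; _+_; _<_)
open import Data.Fin using (Fin; zero; suc)
open import Data.Fin.Permutation using (Permutation′; _⟨$⟩ʳ_)
import Data.Rational
open import Data.Rational using (ℚ; 0ℚ) renaming (_+_ to _+ℚ_)
open import Data.Product using (Σ; _×_; ∃)
open import Relation.Binary.PropositionalEquality using (_≡_)
open import Relation.Nullary using (¬_)

sumℕ : ∀ {n} → (Fin n → ℕ) → ℕ
sumℕ {zero} f = 0
sumℕ {suc n} f = f zero + sumℕ (λ i → f (suc i))

sumℚ : ∀ {n} → (Fin n → ℚ) → ℚ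
sumℚ {zero} f = 0ℚ
sumℚ {suc n} f = f zero +ℚ sumℚ (λ i → f (suc i))

record Graph (n : ℕ) : Set where
  field
    adj       : Fin n → Fin n → Bool
    symmetric : ∀ i j → adj i j ≡ adj j i
    loopless  : ∀ i → adj i i ≡ false
open Graph public

data Reachable {n} (G : Graph n) : Fin n → Fin n → Set where
  here : ∀ {i} → Reachable G i i
  step : ∀ {i j k} → adj G i j ≡ true → Reachable G j k → Reachable G i k

Connected : ∀ {n} → Graph n → Set
Connected G = ∀ i j → Reachable G i j

deg : ∀ {n} → Graph n → Fin n → ℕ
deg G i = sumℕ (λ j → if adj G i j then 1 else 0)

Ax : ∀ {n} → Graph n → (Fin n → ℚ) → Fin n → ℚ
Ax G x i = sumℚ (λ j → if adj G i j then x j else 0ℚ)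

InKernel : ∀ {n} → Graph n → (Fin n → ℚ) → Set
InKernel G x = ∀ i → Ax G x i ≡ 0ℚ

NonZeroVec : ∀ {n} → (Fin n → ℚ) → Set
NonZeroVec x = ¬ (∀ i → x i ≡ 0ℚ)

-- nut graph: not K₁ (n ≥ 2), and ker A(G) is one-dimensional, spanned by a
-- vector with no zero entry
IsNut : ∀ {n} → Graph n → Set
IsNut {n} G =
  1 < n ×
  Σ (Fin n → ℚ) λ y →
    InKernel G y × (∀ i → ¬ (y i ≡ 0ℚ)) ×
    (∀ x → InKernel G x → ∃ λ (c : ℚ) → ∀ i → x i ≡ c Data.Rational.* y i)

IsAut : ∀ {n} → Graph n → Permutation′ n → Set
IsAut G α = ∀ i j → adj G (α ⟨$⟩ʳ i) (α ⟨$⟩ʳ j) ≡ adj G i j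

VertexTransitive : ∀ {n} → Graph n → Set
VertexTransitive {n} G = ∀ (u v : Fin n) → Σ (Permutation′ n) λ α → IsAut G α × (α ⟨$⟩ʳ u ≡ v)

-- The kernel of A(G) is one-dimensional and every automorphism α permutes the
-- coordinates of kernel vectors, so x ∘ α = μ x for some rational μ; comparing
-- the sums of absolute values of both sides gives ∣μ∣ = 1. Vertex-transitivity
-- then makes ∣x∣ constant, so x rescales to a ±1-vector z. A sum of d terms ±1
-- can only vanish when d is even: applied to the row sums of A(G) z this makes
-- every degree even, and applied to ∑ z, which vanishes because d ∑ z is the sum
-- of all row sums of A(G) z, it makes n even.
module Submission where

open import Defs
open import Data.Nat using (ℕ)
open import Data.Nat.Divisibility using (_∣_)
open import Data.Fin using (Fin)
open import Data.Fin.Permutation using (Permutation′; _⟨$⟩ʳ_)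
open import Data.Rational using (ℚ; 1ℚ; -_; ∣_∣; _*_)
open import Data.Product using (Σ; _×_; ∃)
open import Data.Sum using (_⊎_)
open import Relation.Binary.PropositionalEquality using (_≡_)

open import Algebra.Bundles using (CommutativeRing)
import Algebra.Properties.CommutativeMonoid.Sum as CommutativeMonoidSum
import Algebra.Properties.Group as GroupProperties
import Algebra.Properties.Monoid.Mult as MonoidMult
import Algebra.Properties.Semiring.Sum as SemiringSum
open import Data.Bool using (Bool; true; false; if_then_else_)
open import Data.Empty using (⊥-elim)
open import Data.Fin using (zero; suc)
open import Data.Nat using (zero; suc; s≤s) renaming (_+_ to _+ℕ_)
open import Data.Nat.Divisibility using (m∣m*n)
import Data.Nat.Properties as ℕ
open import Data.Product using (_,_; proj₁; proj₂)
open import Data.Rational using (0ℚ; _+_; 1/_; _≤_; _<_; ≢-nonZero)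
import Data.Rational.Properties as ℚ
open import Data.Rational.Solver using (module +-*-Solver)
open import Data.Sum using (inj₁; inj₂)
open import Function using (_∘_)
open import Relation.Binary.PropositionalEquality
  using (refl; sym; trans; cong; cong₂; subst; _≢_; module ≡-Reasoning)

open ≡-Reasoning

private
  module ℚΣ = SemiringSum (CommutativeRing.semiring ℚ.+-*-commutativeRing)
  module ℕΣ = CommutativeMonoidSum ℕ.+-0-commutativeMonoid
  module ℚ× = MonoidMult ℚ.+-0-monoid
  module ℚ+ = GroupProperties ℚ.+-0-group

sumℚ≡sum : ∀ {n} (f : Fin n → ℚ) → sumℚ f ≡ ℚΣ.sum f
sumℚ≡sum {zero}  f = refl
sumℚ≡sum {suc n} f = cong (f zero +_) (sumℚ≡sum (f ∘ suc))

sumℕ≡sum : ∀ {n} (f : Fin n → ℕ) → sumℕ f ≡ ℕΣ.sum f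
sumℕ≡sum {zero}  f = refl
sumℕ≡sum {suc n} f = cong (f zero +ℕ_) (sumℕ≡sum (f ∘ suc))

sumℚ-cong : ∀ {n} {f g : Fin n → ℚ} → (∀ i → f i ≡ g i) → sumℚ f ≡ sumℚ g
sumℚ-cong {zero}  f≗g = refl
sumℚ-cong {suc n} f≗g = cong₂ _+_ (f≗g zero) (sumℚ-cong (f≗g ∘ suc))

sumℕ-cong : ∀ {n} {f g : Fin n → ℕ} → (∀ i → f i ≡ g i) → sumℕ f ≡ sumℕ g
sumℕ-cong {zero}  f≗g = refl
sumℕ-cong {suc n} f≗g = cong₂ _+ℕ_ (f≗g zero) (sumℕ-cong (f≗g ∘ suc))

sumℚ-permute : ∀ {n} (f : Fin n → ℚ) (π : Permutation′ n) →
               sumℚ (λ i → f (π ⟨$⟩ʳ i)) ≡ sumℚ f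
sumℚ-permute f π = begin
  sumℚ (λ i → f (π ⟨$⟩ʳ i))    ≡⟨ sumℚ≡sum (λ i → f (π ⟨$⟩ʳ i)) ⟩
  ℚΣ.sum (λ i → f (π ⟨$⟩ʳ i))  ≡⟨ ℚΣ.∑-permute f π ⟨
  ℚΣ.sum f                     ≡⟨ sumℚ≡sum f ⟨
  sumℚ f                       ∎

sumℕ-permute : ∀ {n} (f : Fin n → ℕ) (π : Permutation′ n) →
               sumℕ (λ i → f (π ⟨$⟩ʳ i)) ≡ sumℕ f
sumℕ-permute f π = begin
  sumℕ (λ i → f (π ⟨$⟩ʳ i))    ≡⟨ sumℕ≡sum (λ i → f (π ⟨$⟩ʳ i)) ⟩
  ℕΣ.sum (λ i → f (π ⟨$⟩ʳ i))  ≡⟨ ℕΣ.∑-permute f π ⟨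
  ℕΣ.sum f                     ≡⟨ sumℕ≡sum f ⟨
  sumℕ f                       ∎

sumℚ-comm : ∀ {m n} (f : Fin m → Fin n → ℚ) →
            sumℚ (λ i → sumℚ (f i)) ≡ sumℚ (λ j → sumℚ (λ i → f i j))
sumℚ-comm f = begin
  sumℚ (λ i → sumℚ (f i))                ≡⟨ sumℚ-cong (λ i → sumℚ≡sum (f i)) ⟩
  sumℚ (λ i → ℚΣ.sum (f i))              ≡⟨ sumℚ≡sum (λ i → ℚΣ.sum (f i)) ⟩
  ℚΣ.sum (λ i → ℚΣ.sum (f i))            ≡⟨ ℚΣ.∑-comm f ⟩
  ℚΣ.sum (λ j → ℚΣ.sum (λ i → f i j))    ≡⟨ sumℚ≡sum (λ j → ℚΣ.sum (λ i → f i j)) ⟨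
  sumℚ (λ j → ℚΣ.sum (λ i → f i j))      ≡⟨ sumℚ-cong (λ j → sumℚ≡sum (λ i → f i j)) ⟨
  sumℚ (λ j → sumℚ (λ i → f i j))        ∎

*-distribˡ-sumℚ : ∀ {n} c (f : Fin n → ℚ) → c * sumℚ f ≡ sumℚ (λ i → c * f i)
*-distribˡ-sumℚ c f = begin
  c * sumℚ f                 ≡⟨ cong (c *_) (sumℚ≡sum f) ⟩
  c * ℚΣ.sum f               ≡⟨ ℚΣ.*-distribˡ-sum c f ⟩
  ℚΣ.sum (λ i → c * f i)     ≡⟨ sumℚ≡sum (λ i → c * f i) ⟨
  sumℚ (λ i → c * f i)       ∎

sumℚ-zero : ∀ n → sumℚ {n} (λ _ → 0ℚ) ≡ 0ℚ
sumℚ-zero n = trans (sumℚ≡sum {n} (λ _ → 0ℚ)) (ℚΣ.sum-replicate-zero n)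

sumℚ-nonNeg : ∀ {n} (f : Fin n → ℚ) → (∀ i → 0ℚ ≤ f i) → 0ℚ ≤ sumℚ f
sumℚ-nonNeg {zero}  f f≥0 = ℚ.≤-refl
sumℚ-nonNeg {suc n} f f≥0 = ℚ.+-mono-≤ (f≥0 zero) (sumℚ-nonNeg (f ∘ suc) (f≥0 ∘ suc))

sumℚ-pos : ∀ {n} (f : Fin (suc n) → ℚ) → 0ℚ < f zero → (∀ i → 0ℚ ≤ f i) → 0ℚ < sumℚ f
sumℚ-pos f f₀>0 f≥0 =
  ℚ.+-mono-<-≤ {0ℚ} {f zero} {0ℚ} f₀>0 (sumℚ-nonNeg (f ∘ suc) (f≥0 ∘ suc))

*-cancelʳ-≢0 : ∀ p q r → r ≢ 0ℚ → p * r ≡ q * r → p ≡ q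
*-cancelʳ-≢0 p q r r≢0 pr≡qr = begin
  p                   ≡⟨ ℚ.*-identityʳ p ⟨
  p * 1ℚ              ≡⟨ cong (p *_) (ℚ.*-inverseʳ r) ⟨
  p * (r * (1/ r))    ≡⟨ ℚ.*-assoc p r (1/ r) ⟨
  p * r * (1/ r)      ≡⟨ cong (_* (1/ r)) pr≡qr ⟩
  q * r * (1/ r)      ≡⟨ ℚ.*-assoc q r (1/ r) ⟩
  q * (r * (1/ r))    ≡⟨ cong (q *_) (ℚ.*-inverseʳ r) ⟩
  q * 1ℚ              ≡⟨ ℚ.*-identityʳ q ⟩
  q                   ∎
  where instance _ = ≢-nonZero r≢0

*-≢0 : ∀ p q → p ≢ 0ℚ → q ≢ 0ℚ → p * q ≢ 0ℚ
*-≢0 p q p≢0 q≢0 pq≡0 = p≢0 (*-cancelʳ-≢0 p 0ℚ q q≢0 (trans pq≡0 (sym (ℚ.*-zeroˡ q))))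

0<∣p∣ : ∀ p → p ≢ 0ℚ → 0ℚ < ∣ p ∣
0<∣p∣ p p≢0 = ℚ.≰⇒> λ ∣p∣≤0 → p≢0 (ℚ.∣p∣≡0⇒p≡0 p (ℚ.≤-antisym ∣p∣≤0 (ℚ.0≤∣p∣ p)))

infix 4 _≡±_

_≡±_ : ℚ → ℚ → Set
p ≡± q = p ≡ q ⊎ p ≡ - q

∣p∣≡∣q∣⇒p≡±q : ∀ {p q} → ∣ p ∣ ≡ ∣ q ∣ → p ≡± q
∣p∣≡∣q∣⇒p≡±q {p} {q} ∣p∣≡∣q∣ with ℚ.∣p∣≡p∨∣p∣≡-p p | ℚ.∣p∣≡p∨∣p∣≡-p q
... | inj₁ ∣p∣≡p  | inj₁ ∣q∣≡q  = inj₁ (trans (sym ∣p∣≡p) (trans ∣p∣≡∣q∣ ∣q∣≡q))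
... | inj₁ ∣p∣≡p  | inj₂ ∣q∣≡-q = inj₂ (trans (sym ∣p∣≡p) (trans ∣p∣≡∣q∣ ∣q∣≡-q))
... | inj₂ ∣p∣≡-p | inj₁ ∣q∣≡q  =
  inj₂ (ℚ.neg-injective (trans (sym ∣p∣≡-p) (trans ∣p∣≡∣q∣ (trans ∣q∣≡q (sym (ℚ+.⁻¹-involutive q))))))
... | inj₂ ∣p∣≡-p | inj₂ ∣q∣≡-q = inj₁ (ℚ.neg-injective (trans (sym ∣p∣≡-p) (trans ∣p∣≡∣q∣ ∣q∣≡-q)))

*-congˡ-≡± : ∀ r {p q} → p ≡± q → r * p ≡± r * q
*-congˡ-≡± r (inj₁ p≡q)  = inj₁ (cong (r *_) p≡q)
*-congˡ-≡± r (inj₂ p≡-q) = inj₂ (trans (cong (r *_) p≡-q) (sym (ℚ.neg-distribʳ-* r _)))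

SameUpToSign : ∀ {n} → (Fin n → ℚ) → (Fin n → ℚ) → Set
SameUpToSign w x = (∀ i → w i ≡ x i) ⊎ (∀ i → w i ≡ - x i)

uniform-sign : ∀ {n} {w x : Fin n → ℚ} {μ} → (∀ i → w i ≡ μ * x i) → μ ≡± 1ℚ → SameUpToSign w x
uniform-sign {x = x} w≡μx (inj₁ refl) = inj₁ λ i → trans (w≡μx i) (ℚ.*-identityˡ (x i))
uniform-sign {x = x} w≡μx (inj₂ refl) = inj₂ λ i → begin
  _             ≡⟨ w≡μx i ⟩
  - 1ℚ * x i    ≡⟨ ℚ.neg-distribˡ-* 1ℚ (x i) ⟨
  - (1ℚ * x i)  ≡⟨ cong -_ (ℚ.*-identityˡ (x i)) ⟩
  - x i         ∎

SameUpToSign⇒∣∣-equal : ∀ {n} {w x : Fin n → ℚ} → SameUpToSign w x →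
                        ∀ i → ∣ w i ∣ ≡ ∣ x i ∣
SameUpToSign⇒∣∣-equal (inj₁ w≡x)  i = cong ∣_∣ (w≡x i)
SameUpToSign⇒∣∣-equal {x = x} (inj₂ w≡-x) i = trans (cong ∣_∣ (w≡-x i)) (ℚ.∣-p∣≡∣p∣ (x i))

fromℕ : ℕ → ℚ
fromℕ n = n ℚ×.× 1ℚ

fromℕ-+ : ∀ m n → fromℕ (m +ℕ n) ≡ fromℕ m + fromℕ n
fromℕ-+ = ℚ×.×-homo-+ 1ℚ

fromℕ-nonNeg : ∀ n → 0ℚ ≤ fromℕ n
fromℕ-nonNeg zero    = ℚ.≤-refl
fromℕ-nonNeg (suc n) = ℚ.+-mono-≤ {0ℚ} {1ℚ} (ℚ.<⇒≤ (ℚ.positive⁻¹ 1ℚ)) (fromℕ-nonNeg n)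

fromℕ-suc≢0 : ∀ n → fromℕ (suc n) ≢ 0ℚ
fromℕ-suc≢0 n = ℚ.<⇒≢ (ℚ.+-mono-<-≤ {0ℚ} {1ℚ} (ℚ.positive⁻¹ 1ℚ) (fromℕ-nonNeg n)) ∘ sym

fromℕ-injective : ∀ m n → fromℕ m ≡ fromℕ n → m ≡ n
fromℕ-injective zero    zero    _ = refl
fromℕ-injective zero    (suc n) e = ⊥-elim (fromℕ-suc≢0 n (sym e))
fromℕ-injective (suc m) zero    e = ⊥-elim (fromℕ-suc≢0 m e)
fromℕ-injective (suc m) (suc n) e = cong suc (fromℕ-injective m n (ℚ+.∙-cancelˡ 1ℚ _ _ e))

count : ∀ {n} → (Fin n → Bool) → ℕ
count f = sumℕ (λ i → if f i then 1 else 0)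

count-true : ∀ n → count {n} (λ _ → true) ≡ n
count-true zero    = refl
count-true (suc n) = cong suc (count-true n)

count≢0 : ∀ {n} (f : Fin n → Bool) j → f j ≡ true → count f ≢ 0
count≢0 f zero    f₀≡true with f zero
count≢0 f zero    ()      | false
count≢0 f zero    _       | true  = λ ()
count≢0 f (suc j) fj≡true with f zero
... | false = count≢0 (f ∘ suc) j fj≡true
... | true  = λ ()

count-permute : ∀ {n} (f : Fin n → Bool) (π : Permutation′ n) → count (λ i → f (π ⟨$⟩ʳ i)) ≡ count f
count-permute f = sumℕ-permute (λ i → if f i then 1 else 0)

sumℚ-if-const : ∀ {n} (f : Fin n → Bool) a →
                sumℚ (λ i → if f i then a else 0ℚ) ≡ fromℕ (count f) * a
sumℚ-if-const {zero}  f a = sym (ℚ.*-zeroˡ a)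
sumℚ-if-const {suc n} f a with f zero
... | true  = begin
  a + sumℚ (λ i → if f (suc i) then a else 0ℚ)   ≡⟨ cong (a +_) (sumℚ-if-const (f ∘ suc) a) ⟩
  a + fromℕ (count (f ∘ suc)) * a                ≡⟨ cong (_+ fromℕ (count (f ∘ suc)) * a) (ℚ.*-identityˡ a) ⟨
  1ℚ * a + fromℕ (count (f ∘ suc)) * a           ≡⟨ ℚ.*-distribʳ-+ a 1ℚ (fromℕ (count (f ∘ suc))) ⟨
  (1ℚ + fromℕ (count (f ∘ suc))) * a             ∎
... | false = trans (ℚ.+-identityˡ (sumℚ (λ i → if f (suc i) then a else 0ℚ))) (sumℚ-if-const (f ∘ suc) a)

±1-extend-complement : ∀ {t} s m c → t ≡± 1ℚ → s + fromℕ m + fromℕ m ≡ fromℕ c →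
                       ∃ λ m′ → t + s + fromℕ m′ + fromℕ m′ ≡ fromℕ (suc c)
±1-extend-complement s m c (inj₁ refl) e = m , (begin
  1ℚ + s + fromℕ m + fromℕ m                   ≡⟨ solve 2 (λ s k → con 1ℚ :+ s :+ k :+ k := con 1ℚ :+ (s :+ k :+ k)) refl s (fromℕ m) ⟩
  1ℚ + (s + fromℕ m + fromℕ m)                 ≡⟨ cong (1ℚ +_) e ⟩
  1ℚ + fromℕ c                                 ∎)
  where open +-*-Solver
±1-extend-complement s m c (inj₂ refl) e = suc m , (begin
  - 1ℚ + s + (1ℚ + fromℕ m) + (1ℚ + fromℕ m)   ≡⟨ solve 2 (λ s k → :- con 1ℚ :+ s :+ (con 1ℚ :+ k) :+ (con 1ℚ :+ k)
                                                             := con 1ℚ :+ (s :+ k :+ k)) refl s (fromℕ m) ⟩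
  1ℚ + (s + fromℕ m + fromℕ m)                 ≡⟨ cong (1ℚ +_) e ⟩
  1ℚ + fromℕ c                                 ∎)
  where open +-*-Solver

-- A selection of k entries from a ±1-vector sums to k - 2m, where m counts the selected -1's.
sum-±1-complement : ∀ {n} (f : Fin n → Bool) (z : Fin n → ℚ) → (∀ i → z i ≡± 1ℚ) →
  ∃ λ m → sumℚ (λ i → if f i then z i else 0ℚ) + fromℕ m + fromℕ m ≡ fromℕ (count f)
sum-±1-complement {zero}  f z z≡±1 = 0 , refl
sum-±1-complement {suc n} f z z≡±1
  with sum-±1-complement (f ∘ suc) (z ∘ suc) (z≡±1 ∘ suc) | f zero
... | m , e | false = m , trans (cong (λ s → s + fromℕ m + fromℕ m) (ℚ.+-identityˡ S)) e
  where S : ℚ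
        S = sumℚ (λ i → if f (suc i) then z (suc i) else 0ℚ)
... | m , e | true  = ±1-extend-complement S m (count (f ∘ suc)) (z≡±1 zero) e
  where S : ℚ
        S = sumℚ (λ i → if f (suc i) then z (suc i) else 0ℚ)

even-count : ∀ {n} (f : Fin n → Bool) (z : Fin n → ℚ) → (∀ i → z i ≡± 1ℚ) →
             sumℚ (λ i → if f i then z i else 0ℚ) ≡ 0ℚ → 2 ∣ count f
even-count f z z≡±1 sum≡0 with sum-±1-complement f z z≡±1
... | m , e = subst (2 ∣_) m+m≡count (subst (λ k → 2 ∣ m +ℕ k) (ℕ.+-identityʳ m) (m∣m*n m))
  where
  m+m≡count : m +ℕ m ≡ count f
  m+m≡count = fromℕ-injective _ _ (begin
    fromℕ (m +ℕ m)                                 ≡⟨ fromℕ-+ m m ⟩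
    fromℕ m + fromℕ m                              ≡⟨ ℚ.+-identityˡ (fromℕ m + fromℕ m) ⟨
    0ℚ + (fromℕ m + fromℕ m)                       ≡⟨ ℚ.+-assoc 0ℚ (fromℕ m) (fromℕ m) ⟨
    0ℚ + fromℕ m + fromℕ m                         ≡⟨ cong (λ s → s + fromℕ m + fromℕ m) sum≡0 ⟨
    sumℚ (λ i → if f i then z i else 0ℚ) + fromℕ m + fromℕ m   ≡⟨ e ⟩
    fromℕ (count f)                                ∎)

module _ {n} (G : Graph n) where

  InKernel-scale : ∀ c x → InKernel G x → InKernel G (λ i → c * x i)
  InKernel-scale c x x∈ker i = begin
    sumℚ (λ j → if adj G i j then c * x j else 0ℚ)   ≡⟨ sumℚ-cong (λ j → scale-if (adj G i j) (x j)) ⟩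
    sumℚ (λ j → c * (if adj G i j then x j else 0ℚ)) ≡⟨ *-distribˡ-sumℚ c (λ j → if adj G i j then x j else 0ℚ) ⟨
    c * Ax G x i                                      ≡⟨ cong (c *_) (x∈ker i) ⟩
    c * 0ℚ                                            ≡⟨ ℚ.*-zeroʳ c ⟩
    0ℚ                                                ∎
    where
    scale-if : ∀ b a → (if b then c * a else 0ℚ) ≡ c * (if b then a else 0ℚ)
    scale-if true  a = refl
    scale-if false a = sym (ℚ.*-zeroʳ c)

  InKernel-∘aut : ∀ α → IsAut G α → ∀ x → InKernel G x → InKernel G (λ i → x (α ⟨$⟩ʳ i))
  InKernel-∘aut α α-aut x x∈ker i = begin
    sumℚ (λ j → if adj G i j then x (α ⟨$⟩ʳ j) else 0ℚ)
      ≡⟨ sumℚ-cong (λ j → cong (λ b → if b then x (α ⟨$⟩ʳ j) else 0ℚ) (α-aut i j)) ⟨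
    sumℚ (λ j → if adj G (α ⟨$⟩ʳ i) (α ⟨$⟩ʳ j) then x (α ⟨$⟩ʳ j) else 0ℚ)
      ≡⟨ sumℚ-permute (λ k → if adj G (α ⟨$⟩ʳ i) k then x k else 0ℚ) α ⟩
    Ax G x (α ⟨$⟩ʳ i)
      ≡⟨ x∈ker (α ⟨$⟩ʳ i) ⟩
    0ℚ ∎

  deg-∘aut : ∀ α → IsAut G α → ∀ i → deg G (α ⟨$⟩ʳ i) ≡ deg G i
  deg-∘aut α α-aut i = begin
    count (adj G (α ⟨$⟩ʳ i))                          ≡⟨ count-permute (adj G (α ⟨$⟩ʳ i)) α ⟨
    count (λ j → adj G (α ⟨$⟩ʳ i) (α ⟨$⟩ʳ j))          ≡⟨ sumℕ-cong (λ j → cong (λ b → if b then 1 else 0) (α-aut i j)) ⟩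
    count (adj G i)                                   ∎

  VertexTransitive⇒regular : VertexTransitive G → ∀ i j → deg G j ≡ deg G i
  VertexTransitive⇒regular vt i j with vt i j
  ... | α , α-aut , refl = deg-∘aut α α-aut i

  Reachable⇒deg≢0 : ∀ {i j} → Reachable G i j → i ≢ j → deg G i ≢ 0
  Reachable⇒deg≢0 here                   i≢i = ⊥-elim (i≢i refl)
  Reachable⇒deg≢0 (step {j = k} i~k _) _   = count≢0 (adj G _) k i~k

  sum-Ax : ∀ x → sumℚ (Ax G x) ≡ sumℚ (λ j → fromℕ (deg G j) * x j)
  sum-Ax x = begin
    sumℚ (λ i → sumℚ (λ j → if adj G i j then x j else 0ℚ))   ≡⟨ sumℚ-comm (λ i j → if adj G i j then x j else 0ℚ) ⟩
    sumℚ (λ j → sumℚ (λ i → if adj G i j then x j else 0ℚ))   ≡⟨ sumℚ-cong column ⟩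
    sumℚ (λ j → fromℕ (deg G j) * x j)                         ∎
    where
    column : ∀ j → sumℚ (λ i → if adj G i j then x j else 0ℚ) ≡ fromℕ (deg G j) * x j
    column j = trans (sumℚ-if-const (λ i → adj G i j) (x j))
      (cong (λ d → fromℕ d * x j) (sumℕ-cong (λ i → cong (λ b → if b then 1 else 0) (symmetric G i j))))

  VertexTransitive⇒∣∣-constant : VertexTransitive G → ∀ x →
    (∀ α → IsAut G α → SameUpToSign (λ i → x (α ⟨$⟩ʳ i)) x) →
    ∀ i j → ∣ x i ∣ ≡ ∣ x j ∣
  VertexTransitive⇒∣∣-constant vt x sign i j with vt i j
  ... | α , α-aut , refl = sym (SameUpToSign⇒∣∣-equal {w = λ k → x (α ⟨$⟩ʳ k)} {x} (sign α α-aut) i)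

  regular-kernel-sum : ∀ {d} → (∀ j → deg G j ≡ d) → d ≢ 0 → ∀ x → InKernel G x → sumℚ x ≡ 0ℚ
  regular-kernel-sum {d} regular d≢0 x x∈ker =
    *-cancelʳ-≢0 (sumℚ x) 0ℚ (fromℕ d) (d≢0 ∘ fromℕ-injective d 0) (begin
      sumℚ x * fromℕ d                     ≡⟨ ℚ.*-comm (sumℚ x) (fromℕ d) ⟩
      fromℕ d * sumℚ x                     ≡⟨ *-distribˡ-sumℚ (fromℕ d) x ⟩
      sumℚ (λ j → fromℕ d * x j)           ≡⟨ sumℚ-cong (λ j → cong (λ e → fromℕ e * x j) (regular j)) ⟨
      sumℚ (λ j → fromℕ (deg G j) * x j)   ≡⟨ sum-Ax x ⟨
      sumℚ (Ax G x)                        ≡⟨ sumℚ-cong {n} x∈ker ⟩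
      sumℚ {n} (λ _ → 0ℚ)                  ≡⟨ sumℚ-zero n ⟩
      0ℚ                                   ≡⟨ ℚ.*-zeroˡ (fromℕ d) ⟨
      0ℚ * fromℕ d                         ∎)

  ±1-kernel-vector⇒even-degree : ∀ z → InKernel G z → (∀ i → z i ≡± 1ℚ) → ∀ v → 2 ∣ deg G v
  ±1-kernel-vector⇒even-degree z z∈ker z≡±1 v = even-count (adj G v) z z≡±1 (z∈ker v)

  ±1-kernel-vector⇒even-order : ∀ {d} → (∀ j → deg G j ≡ d) → d ≢ 0 →
                                ∀ z → InKernel G z → (∀ i → z i ≡± 1ℚ) → 2 ∣ n
  ±1-kernel-vector⇒even-order regular d≢0 z z∈ker z≡±1 = subst (2 ∣_) (count-true n)
    (even-count (λ _ → true) z z≡±1 (regular-kernel-sum regular d≢0 z z∈ker))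

-- Permuting coordinates preserves ∑ ∣vᵢ∣, which is positive and scales by ∣μ∣.
permutation-eigenvalue-±1 : ∀ {n} (α : Permutation′ (suc n)) (v : Fin (suc n) → ℚ) μ →
                            v zero ≢ 0ℚ → (∀ i → v (α ⟨$⟩ʳ i) ≡ μ * v i) → μ ≡± 1ℚ
permutation-eigenvalue-±1 α v μ v₀≢0 v∘α≡μv =
  ∣p∣≡∣q∣⇒p≡±q (*-cancelʳ-≢0 ∣ μ ∣ 1ℚ S S≢0 (begin
    ∣ μ ∣ * S                          ≡⟨ *-distribˡ-sumℚ ∣ μ ∣ (∣_∣ ∘ v) ⟩
    sumℚ (λ i → ∣ μ ∣ * ∣ v i ∣)       ≡⟨ sumℚ-cong (λ i → ℚ.∣p*q∣≡∣p∣*∣q∣ μ (v i)) ⟨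
    sumℚ (λ i → ∣ μ * v i ∣)           ≡⟨ sumℚ-cong (λ i → cong ∣_∣ (v∘α≡μv i)) ⟨
    sumℚ (λ i → ∣ v (α ⟨$⟩ʳ i) ∣)      ≡⟨ sumℚ-permute (∣_∣ ∘ v) α ⟩
    S                                  ≡⟨ ℚ.*-identityˡ S ⟨
    1ℚ * S                             ∎))
  where
  S : ℚ
  S = sumℚ (∣_∣ ∘ v)
  S≢0 : S ≢ 0ℚ
  S≢0 = ℚ.<⇒≢ (sumℚ-pos (∣_∣ ∘ v) (0<∣p∣ (v zero) v₀≢0) (ℚ.0≤∣p∣ ∘ v)) ∘ sym

rescale-span : ∀ {n} {x y z : Fin n → ℚ} k l → k ≢ 0ℚ →
               (∀ i → x i ≡ k * y i) → (∀ i → z i ≡ l * y i) → ∃ λ μ → ∀ i → z i ≡ μ * x i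
rescale-span {x = x} {y} {z} k l k≢0 x≡ky z≡ly = l * 1/ k , λ i → begin
  z i                      ≡⟨ z≡ly i ⟩
  l * y i                  ≡⟨ cong (_* y i) (ℚ.*-identityʳ l) ⟨
  l * 1ℚ * y i             ≡⟨ cong (λ t → l * t * y i) (ℚ.*-inverseˡ k) ⟨
  l * (1/ k * k) * y i     ≡⟨ solve 4 (λ l k' k y → l :* (k' :* k) :* y := l :* k' :* (k :* y)) refl l (1/ k) k (y i) ⟩
  l * 1/ k * (k * y i)     ≡⟨ cong (l * 1/ k *_) (x≡ky i) ⟨
  l * 1/ k * x i           ∎
  where instance _ = ≢-nonZero k≢0
        open +-*-Solver

∣∣-constant⇒±1-rescaling : ∀ {n} (x : Fin (suc n) → ℚ) → x zero ≢ 0ℚ → (∀ i → ∣ x i ∣ ≡ ∣ x zero ∣) →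
                           ∃ λ c → ∀ i → c * x i ≡± 1ℚ
∣∣-constant⇒±1-rescaling x x₀≢0 ∣x∣-constant =
  1/ x zero , λ i → subst (1/ x zero * x i ≡±_) (ℚ.*-inverseˡ (x zero))
                          (*-congˡ-≡± (1/ x zero) (∣p∣≡∣q∣⇒p≡±q (∣x∣-constant i)))
  where instance _ = ≢-nonZero x₀≢0

nut-kernel-vector : ∀ {n} (G : Graph n) → IsNut G → ∀ x → InKernel G x → NonZeroVec x →
                    (∀ i → x i ≢ 0ℚ) × (∀ w → InKernel G w → ∃ λ μ → ∀ i → w i ≡ μ * x i)
nut-kernel-vector G (_ , y , _ , y≢0 , y-spans) x x∈ker x≢0 with y-spans x x∈ker
... | k , x≡ky =
  (λ i → subst (_≢ 0ℚ) (sym (x≡ky i)) (*-≢0 k (y i) k≢0 (y≢0 i))) ,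
  (λ w w∈ker → rescale-span k (proj₁ (y-spans w w∈ker)) k≢0 x≡ky (proj₂ (y-spans w w∈ker)))
  where
  k≢0 : k ≢ 0ℚ
  k≢0 k≡0 = x≢0 λ i → trans (x≡ky i) (trans (cong (_* y i) k≡0) (ℚ.*-zeroˡ (y i)))

automorphism-sign : ∀ {n} (G : Graph (suc n)) → IsNut G → ∀ x → InKernel G x → NonZeroVec x →
                    ∀ α → IsAut G α → SameUpToSign (λ i → x (α ⟨$⟩ʳ i)) x
automorphism-sign G nut x x∈ker x≢0 α α-aut =
  let x≢0ᵢ , x-spans = nut-kernel-vector G nut x x∈ker x≢0
      μ , x∘α≡μx = x-spans (λ i → x (α ⟨$⟩ʳ i)) (InKernel-∘aut G α α-aut x x∈ker)
  in uniform-sign x∘α≡μx (permutation-eigenvalue-±1 α x μ (x≢0ᵢ zero) x∘α≡μx)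

lemma5 : ∀ (n : ℕ) (G : Graph n) → Connected G → IsNut G → VertexTransitive G →
         ∀ (x : Fin n → ℚ) → InKernel G x → NonZeroVec x →
         (∀ (α : Permutation′ n) → IsAut G α →
            (∀ i → x (α ⟨$⟩ʳ i) ≡ x i) ⊎ (∀ i → x (α ⟨$⟩ʳ i) ≡ - x i))
         × (∀ i j → ∣ x i ∣ ≡ ∣ x j ∣)
         × (∃ λ (c : ℚ) → ∀ i → (c * x i ≡ 1ℚ) ⊎ (c * x i ≡ - 1ℚ))
         × (∀ v → 2 ∣ deg G v)
         × (2 ∣ n)
lemma5 zero       _ _ (() , _) _ _ _ _
lemma5 (suc zero) _ _ (s≤s () , _) _ _ _ _
lemma5 (suc (suc _)) G connected nut vt x x∈ker x≢0 =
  sign , ∣x∣-constant , (c , cx≡±1) ,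
  ±1-kernel-vector⇒even-degree G z z∈ker cx≡±1 ,
  ±1-kernel-vector⇒even-order G (VertexTransitive⇒regular G vt zero) deg₀≢0 z z∈ker cx≡±1
  where
  sign : ∀ α → IsAut G α → SameUpToSign (λ i → x (α ⟨$⟩ʳ i)) x
  sign = automorphism-sign G nut x x∈ker x≢0
  ∣x∣-constant : ∀ i j → ∣ x i ∣ ≡ ∣ x j ∣
  ∣x∣-constant = VertexTransitive⇒∣∣-constant G vt x sign
  x₀≢0 : x zero ≢ 0ℚ
  x₀≢0 = proj₁ (nut-kernel-vector G nut x x∈ker x≢0) zero
  rescaling : ∃ λ c → ∀ i → c * x i ≡± 1ℚ
  rescaling = ∣∣-constant⇒±1-rescaling x x₀≢0 (λ i → ∣x∣-constant i zero)
  c : ℚ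
  c = proj₁ rescaling
  cx≡±1 : ∀ i → c * x i ≡± 1ℚ
  cx≡±1 = proj₂ rescaling
  z : Fin _ → ℚ
  z i = c * x i
  z∈ker : InKernel G z
  z∈ker = InKernel-scale G c x x∈ker
  deg₀≢0 : deg G zero ≢ 0
  deg₀≢0 = Reachable⇒deg≢0 G (connected zero (suc zero)) (λ ())
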